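{- Let $\Pi_{42}$ be the map on $\mathbb{N}=\{1,2,3,\dots\}$ produced by the following procedure, with $L(m)=R(m)=\lfloor (m+1)/2\rfloor$. At step $1$ set $\Pi_{42}(1)=1$. For $m=2,3,4,\dots$ in turn, at step $m$: if $\Pi_{42}(m-L(m))$ has not been assigned at an earlier step, set $\Pi_{42}(m-L(m))=m$; otherwise set $\Pi_{42}(m+R(m))=m$. Let $R_{\rm pos}(1)<R_{\rm pos}(2)<\cdots$ be the increasing enumeration of the record positions of $\Pi_{42}$ and $R_{\rm rec}(n)=\Pi_{42}(R_{\rm pos}(n))$. Let $\tau$ be the morphism on $\{1,2,3,4\}^*$ given by $\tau(1)=21$, $\tau(2)=213$, $\tau(3)=2133$, $\tau(4)=4213$, and let $t=t(1)t(2)\dots=4213213212\dots$ be its fixed point starting with $4$. Then for all $n\ge2$, $R_{\rm pos}(n+2)-R_{\rm pos}(n+1)=t(n)$ and $R_{\rm rec}(n+2)-R_{\rm rec}(n+1)=2t(n)$.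
   Context: The procedure assigns a value $\Pi_{42}(n)$ to every $n\in\mathbb{N}$. A position $n\ge1$ is a record position of $\Pi_{42}$ if $\Pi_{42}(n)>\Pi_{42}(m)$ for all $1\le m<n$ (so $1$ is a record position). (The paper writes this as $\Delta R_{\rm pos}(n+1)=t(n)$, $\Delta R_{\rm rec}(n+1)=2t(n)$ for $n\ge2$, with $\Delta x(j)=x(j+1)-x(j)$.) -}

module Defs where

open import Data.Nat using (ℕ; zero; suc; _+_; _*_; _∸_; _≤_; _<_; ⌊_/2⌋)
open import Data.Nat.Properties using (_≟_)
open import Data.Maybe using (Maybe; just; nothing; fromMaybe)
open import Data.List using (List; []; _∷_; concatMap)
open import Data.Product using (Σ; _×_)
open import Relation.Binary.PropositionalEquality using (_≡_)
open import Relation.Nullary using (yes; no)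

L R : ℕ → ℕ
L m = ⌊ suc m /2⌋
R m = ⌊ suc m /2⌋

-- A partial assignment: position ↦ value (nothing = not yet assigned).
State : Set
State = ℕ → Maybe ℕ

update : State → ℕ → ℕ → State
update s p v q with q ≟ p
... | yes _ = just v
... | no  _ = s q

-- state m = the partial map Π₄₂ after steps 1,…,m of the procedure
-- (state 0 = nothing assigned).
state : ℕ → State
state zero = λ _ → nothing
state (suc zero) = update (λ _ → nothing) 1 1
state (suc (suc k)) = step (state (suc k)) (suc (suc k))
  where
  step : State → ℕ → State
  step s m with s (m ∸ L m)
  ... | nothing = update s (m ∸ L m) m
  ... | just _  = update s (m + R m) m

-- Position k ≥ 1 is assigned
-- at the latest at step 2k (at step 2k the procedure looks at position
-- 2k - L(2k) = k and assigns it if it is still free), and an assigned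
-- value is never changed afterwards, so we read it off after step 2k.
Π42 : ℕ → ℕ
Π42 k = fromMaybe 0 (state (2 * k) k)

IsRecordPos : ℕ → Set
IsRecordPos n = 1 ≤ n × (∀ m → 1 ≤ m → m < n → Π42 m < Π42 n)

-- f(1) < f(2) < ⋯ is the increasing enumeration of the record positions
-- (f 0 is irrelevant)
IsRecordEnumeration : (ℕ → ℕ) → Set
IsRecordEnumeration f =
  (∀ k → 1 ≤ k → f k < f (suc k)) ×
  (∀ k → 1 ≤ k → IsRecordPos (f k)) ×
  (∀ p → IsRecordPos p → Σ ℕ λ k → 1 ≤ k × f k ≡ p)

τ : ℕ → List ℕ
τ 1 = 2 ∷ 1 ∷ []
τ 2 = 2 ∷ 1 ∷ 3 ∷ []
τ 3 = 2 ∷ 1 ∷ 3 ∷ 3 ∷ []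
τ 4 = 4 ∷ 2 ∷ 1 ∷ 3 ∷ []
τ _ = []

τ* : List ℕ → List ℕ
τ* = concatMap τ

τ^ : ℕ → List ℕ
τ^ zero = 4 ∷ []
τ^ (suc k) = τ* (τ^ k)

-- 0-indexed lookup with default 0
at : List ℕ → ℕ → ℕ
at [] _ = 0
at (x ∷ xs) zero = x
at (x ∷ xs) (suc i) = at xs i

-- t(n), 1-indexed letter of the fixed point of τ starting with 4.
-- τ^n(4) is a prefix of the fixed point of length ≥ n, so its (n-1)-th
-- (0-indexed) letter is t(n).
t : ℕ → ℕ
t n = at (τ^ n) (n ∸ 1)

-- Proof idea.  Π₄₂ has a closed form governed by a ternary notion of *free*
-- position (one still unassigned when step 2n inspects it): a free q carries
-- 2q, a taken one carries 2u at 3u and 2u+1 at 3u+2.  The file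
--   1. defines free and the closed form `value`, and computes the preimages of
--      every value;
--   2. shows by induction on the steps that the procedure's partial map after
--      step m is exactly the closed form restricted to values ≤ m, hence
--      Π₄₂ = value;
--   3. characterises the record positions as 1 and the free positions, so that
--      consecutive records are x and next x = x + gap x with gap x ∈ {1,2,3};
--   4. proves the self-similarity y ↦ 3y - 2 of the free positions: the gaps
--      between the images of consecutive free y, y' spell τ(y' - y), so the
--      gap word from 4 is the fixed point t of τ after its first letter;
--   5. shows that every record enumeration runs 1, 2, 4, next 4, …, from which
--      the theorem (a record at x is followed by x + t(n), with value 2x) is
--      read off.
module Submission where

open import Defs
open import Data.Nat using (ℕ; zero; suc; _+_; _*_; _∸_; _≤_; _<_; z≤n; s≤s; _≤?_)
open import Data.Nat.Properties
open import Data.Nat.GeneralisedArithmetic using (fold; iterate; iterate-is-fold)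
open import Data.Nat.Tactic.RingSolver using (solve-∀)
open import Data.Bool using (Bool; true; false)
open import Data.Maybe using (just; nothing; fromMaybe)
open import Data.List using (List; []; _∷_; _++_)
open import Data.Product using (_×_; _,_; Σ; proj₁; proj₂)
open import Data.Sum using (_⊎_; inj₁; inj₂)
open import Relation.Nullary using (yes; no; contradiction)
open import Relation.Binary.PropositionalEquality
open import Relation.Binary.Definitions using (tri<; tri≈; tri>)

data Digit : Set where
  d0 d1 d2 : Digit

-- triple u = 3u, by structural recursion so that it computes on open terms.
triple : ℕ → ℕ
triple zero    = zero
triple (suc u) = suc (suc (suc (triple u)))

-- Successor on pairs (quotient, residue) representing 3q + r.
suc₃ : ℕ × Digit → ℕ × Digit
suc₃ (q , d0) = q , d1
suc₃ (q , d1) = q , d2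
suc₃ (q , d2) = suc q , d0

divMod3 : ℕ → ℕ × Digit
divMod3 zero    = 0 , d0
divMod3 (suc n) = suc₃ (divMod3 n)

divMod3-triple : ∀ u → divMod3 (triple u) ≡ (u , d0)
divMod3-triple zero    = refl
divMod3-triple (suc u) rewrite divMod3-triple u = refl

triple-≥ : ∀ u → u ≤ triple u
triple-≥ zero    = z≤n
triple-≥ (suc u) = s≤s (m≤n⇒m≤1+n (m≤n⇒m≤1+n (triple-≥ u)))

triple-≡ : ∀ u → triple u ≡ u + u + u
triple-≡ zero    = refl
triple-≡ (suc u) = trans (cong (λ x → suc (suc (suc x))) (triple-≡ u)) (shift u)
  where
  shift : ∀ u → suc (suc (suc (u + u + u))) ≡ suc u + suc u + suc u
  shift = solve-∀

data Mod3 : ℕ → Set where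
  rem0 : ∀ u → Mod3 (triple u)
  rem1 : ∀ u → Mod3 (suc (triple u))
  rem2 : ∀ u → Mod3 (suc (suc (triple u)))

mod3 : ∀ n → Mod3 n
mod3 zero = rem0 0
mod3 (suc n) with mod3 n
... | rem0 u = rem1 u
... | rem1 u = rem2 u
... | rem2 u = rem0 (suc u)

data Parity : ℕ → Set where
  even : ∀ J → Parity (J + J)
  odd  : ∀ J → Parity (suc (J + J))

parity : ∀ m → Parity m
parity zero = even 0
parity (suc m) with parity m
... | even J = odd J
... | odd J  = subst Parity (cong suc (+-suc J J)) (even (suc J))

twice : ∀ a → a + a ≡ 2 * a
twice a = cong (a +_) (sym (+-identityʳ a))

double-injective : ∀ a b → a + a ≡ b + b → a ≡ b
double-injective a b e = *-cancelˡ-≡ a b 2 (trans (sym (twice a)) (trans e (twice b)))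

double≢odd : ∀ a b → a + a ≢ suc (b + b)
double≢odd a b e = even≢odd a b (trans (sym (twice a)) (trans e (cong suc (twice b))))

odd<even : ∀ {a b} → a < b → suc (a + a) < b + b
odd<even {a} {b} a<b = ≤-trans (s≤s (≤-reflexive (sym (+-suc a a)))) (+-mono-≤ a<b a<b)

-- Position n is meant to be *free* if it is still unassigned
-- when step 2n of the procedure inspects it (2n - L(2n) = n); the invariant
-- state≡assignedAfter below confirms this reading.  The definition is ternary:
-- 2 and every 3u+1 with u ≥ 1 are free; 0, 1 and every 3u+2 with u ≥ 1 are not
-- (step 2u+1 puts 2u+1 at 3u+2); 3u with u ≥ 1 is free exactly when u is (step
-- 2u puts 2u at 3u when u itself was taken).  freeWithin f n evaluates this
-- recursion with fuel f; free n uses fuel n + 1.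
freeStep : (ℕ → Bool) → ℕ × Digit → Bool
freeStep free? (zero  , d0) = false
freeStep free? (suc u , d0) = free? (suc u)
freeStep free? (zero  , d1) = false
freeStep free? (suc u , d1) = true
freeStep free? (zero  , d2) = true
freeStep free? (suc u , d2) = false

freeWithin : ℕ → ℕ → Bool
freeWithin zero    n = false
freeWithin (suc f) n = freeStep (freeWithin f) (divMod3 n)

free : ℕ → Bool
free n = freeWithin (suc n) n

freeWithin-fuel : ∀ f g n → n < f → n < g → freeWithin f n ≡ freeWithin g n
freeWithin-fuel (suc f) (suc g) n n<f n<g with mod3 n
... | rem0 zero    = refl
... | rem0 (suc u) rewrite divMod3-triple u = freeWithin-fuel f g (suc u) (shrink n<f) (shrink n<g)
  where
  shrink : ∀ {h} → suc (triple (suc u)) ≤ suc h → suc u < h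
  shrink (s≤s le) = ≤-trans (s≤s (s≤s (≤-trans (triple-≥ u) (n≤1+n _)))) le
... | rem1 zero    = refl
... | rem1 (suc u) rewrite divMod3-triple u = refl
... | rem2 zero    = refl
... | rem2 (suc u) rewrite divMod3-triple u = refl

free-3u : ∀ u → free (triple (suc u)) ≡ free (suc u)
free-3u u rewrite divMod3-triple u =
  freeWithin-fuel _ _ (suc u) (s≤s (s≤s (≤-trans (triple-≥ u) (n≤1+n _)))) ≤-refl

free-3u+1 : ∀ u → free (suc (triple (suc u))) ≡ true
free-3u+1 u rewrite divMod3-triple u = refl

free-3u+2 : ∀ u → free (suc (suc (triple (suc u)))) ≡ false
free-3u+2 u rewrite divMod3-triple u = refl

no-three-taken : ∀ x → 1 ≤ x → free (suc x) ≡ false → free (suc (suc x)) ≡ false →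
                 free (suc (suc (suc x))) ≡ true
no-three-taken x 1≤x f1 f2 with mod3 x
... | rem0 zero    = contradiction 1≤x λ ()
... | rem0 (suc u) = contradiction (trans (sym (free-3u+1 u)) f1) λ ()
... | rem1 u       = free-3u+1 u
... | rem2 u       = contradiction (trans (sym (free-3u+1 u)) f2) λ ()

-- The closed form of Π₄₂.  A free position q receives 2q at step 2q.  A
-- position that is not free was filled earlier: 3u by 2u, 3u+2 by 2u+1, and
-- position 1 by 1 at step 1.
takenValue : ℕ × Digit → ℕ
takenValue (u , d0) = u + u
takenValue (u , d1) = 1
takenValue (u , d2) = suc (u + u)

valueBy : Bool → ℕ → ℕ
valueBy true  q = q + q
valueBy false q = takenValue (divMod3 q)

value : ℕ → ℕ
value q = valueBy (free q) q

value-free : ∀ q → free q ≡ true → value q ≡ q + q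
value-free q e = cong (λ b → valueBy b q) e

value-taken : ∀ q → free q ≡ false → value q ≡ takenValue (divMod3 q)
value-taken q e = cong (λ b → valueBy b q) e

value-3u : ∀ u → free (suc u) ≡ false → value (triple (suc u)) ≡ suc u + suc u
value-3u u e = trans (value-taken (triple (suc u)) (trans (free-3u u) e)) (cong takenValue (divMod3-triple (suc u)))

value-3u+1 : ∀ u → value (suc (triple (suc u))) ≡ suc (triple (suc u)) + suc (triple (suc u))
value-3u+1 u = value-free (suc (triple (suc u))) (free-3u+1 u)

value-3u+2 : ∀ u → value (suc (suc (triple (suc u)))) ≡ suc (suc u + suc u)
value-3u+2 u = trans (value-taken (suc (suc (triple (suc u)))) (free-3u+2 u)) (cong (λ r → takenValue (suc₃ (suc₃ r))) (divMod3-triple (suc u)))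

takenValue-< : ∀ q → 1 ≤ q → takenValue (divMod3 q) < q + q
takenValue-< q 1≤q with mod3 q
... | rem0 zero    = contradiction 1≤q λ ()
... | rem0 (suc u) rewrite divMod3-triple (suc u) = +-mono-< below below
  where
  below : suc u < triple (suc u)
  below = s≤s (s≤s (≤-trans (triple-≥ u) (n≤1+n _)))
... | rem1 u rewrite divMod3-triple u = s≤s (subst (1 ≤_) (sym (+-suc (triple u) (triple u))) (s≤s z≤n))
... | rem2 u rewrite divMod3-triple u =
  s≤s (s≤s (+-mono-≤ (triple-≥ u) (≤-trans (triple-≥ u) (≤-trans (n≤1+n _) (n≤1+n _)))))

value-taken-< : ∀ q → 1 ≤ q → free q ≡ false → value q < q + q
value-taken-< q 1≤q e = subst (_< q + q) (sym (value-taken q e)) (takenValue-< q 1≤q)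

value-≤ : ∀ q → value q ≤ q + q
value-≤ q with free q
... | true  = ≤-refl
... | false with q
...   | zero  = z≤n
...   | suc p = <⇒≤ (takenValue-< (suc p) (s≤s z≤n))

takenPreimage-even : ∀ J q → takenValue (divMod3 q) ≡ J + J → q ≡ triple J
takenPreimage-even J q h with mod3 q
... | rem0 u rewrite divMod3-triple u = cong triple (double-injective u J h)
... | rem1 u rewrite divMod3-triple u = contradiction (sym h) (double≢odd J 0)
... | rem2 u rewrite divMod3-triple u = contradiction (sym h) (double≢odd J u)

takenPreimage-odd : ∀ J q → 1 ≤ J → takenValue (divMod3 q) ≡ suc (J + J) → q ≡ suc (suc (triple J))
takenPreimage-odd J q 1≤J h with mod3 q
... | rem0 u rewrite divMod3-triple u = contradiction h (double≢odd u J)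
... | rem1 u rewrite divMod3-triple u = contradiction (sym (suc-injective h)) (double≢0 1≤J)
  where
  double≢0 : 1 ≤ J → J + J ≢ 0
  double≢0 (s≤s _) ()
... | rem2 u rewrite divMod3-triple u = cong (λ v → suc (suc (triple v))) (double-injective u J (suc-injective h))

preimage-even : ∀ J q → 1 ≤ J → value q ≡ J + J →
                (free J ≡ true × q ≡ J) ⊎ (free J ≡ false × q ≡ triple J)
preimage-even J q 1≤J h with free q in e
... | true  = inj₁ (trans (cong free (sym q≡J)) e , q≡J)
  where
  q≡J : q ≡ J
  q≡J = double-injective q J h
... | false = inj₂ (free-J 1≤J q≡3J , q≡3J)
  where
  q≡3J : q ≡ triple J
  q≡3J = takenPreimage-even J q h
  free-J : 1 ≤ J → q ≡ triple J → free J ≡ false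
  free-J (s≤s {n = w} _) refl = trans (sym (free-3u w)) e

preimage-odd : ∀ J q → 1 ≤ J → value q ≡ suc (J + J) → q ≡ suc (suc (triple J))
preimage-odd J q 1≤J h with free q
... | true  = contradiction h (double≢odd q J)
... | false = takenPreimage-odd J q 1≤J h

left right : ℕ → ℕ
left  m = m ∸ L m
right m = m + R m

data StepOutcome (m p T : ℕ) : Set where
  fillsLeft  : value p ≡ m → (∀ q → value q ≡ m → q ≡ p) → StepOutcome m p T
  fillsRight : value p < m → value T ≡ m → (∀ q → value q ≡ m → q ≡ T) → StepOutcome m p T

evenOutcome : ∀ J → 1 ≤ J → StepOutcome (J + J) J (triple J)
evenOutcome (suc j) 1≤J with free (suc j) in e
... | true  = fillsLeft (value-free (suc j) e) unique
  where
  unique : ∀ q → value q ≡ suc j + suc j → q ≡ suc j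
  unique q h with preimage-even (suc j) q 1≤J h
  ... | inj₁ (_ , q≡J)  = q≡J
  ... | inj₂ (taken , _) = contradiction (trans (sym e) taken) λ ()
... | false = fillsRight (value-taken-< (suc j) 1≤J e) (value-3u j e) unique
  where
  unique : ∀ q → value q ≡ suc j + suc j → q ≡ triple (suc j)
  unique q h with preimage-even (suc j) q 1≤J h
  ... | inj₁ (isFree , _) = contradiction (trans (sym isFree) e) λ ()
  ... | inj₂ (_ , q≡3J)   = q≡3J

oddOutcome : ∀ J → 1 ≤ J → StepOutcome (suc (J + J)) J (suc (suc (triple J)))
oddOutcome (suc j) 1≤J = fillsRight (s≤s (value-≤ (suc j))) (value-3u+2 j) (λ q → preimage-odd (suc j) q 1≤J)

inspected-even : ∀ J → (left (J + J) ≡ J) × (right (J + J) ≡ triple J)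
inspected-even J rewrite sym (n≡⌈n+n/2⌉ J) = m+n∸n≡m J J , sym (triple-≡ J)

inspected-odd : ∀ J → (left (suc (J + J)) ≡ J) × (right (suc (J + J)) ≡ suc (suc (triple J)))
inspected-odd J rewrite sym (n≡⌊n+n/2⌋ J) = m+n∸n≡m J J , shift J
  where
  shift : ∀ J → suc (J + J + suc J) ≡ suc (suc (triple J))
  shift J rewrite triple-≡ J = cong suc (+-suc (J + J) J)

stepOutcome : ∀ m → 2 ≤ m → (1 ≤ left m) × StepOutcome m (left m) (right m)
stepOutcome m 2≤m with parity m
... | even zero    = contradiction 2≤m λ ()
... | even (suc j) rewrite proj₁ (inspected-even (suc j)) | proj₂ (inspected-even (suc j)) =
  s≤s z≤n , evenOutcome (suc j) (s≤s z≤n)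
... | odd zero     = contradiction 2≤m λ { (s≤s ()) }
... | odd (suc j)  rewrite proj₁ (inspected-odd (suc j)) | proj₂ (inspected-odd (suc j)) =
  s≤s z≤n , oddOutcome (suc j) (s≤s z≤n)

value-positive : ∀ q → 1 ≤ q → 1 ≤ value q
value-positive q 1≤q with free q | mod3 q
... | true  | _            = ≤-trans 1≤q (m≤m+n q q)
... | false | rem0 zero    = contradiction 1≤q λ ()
... | false | rem0 (suc u) rewrite divMod3-triple (suc u) = s≤s z≤n
... | false | rem1 u       rewrite divMod3-triple u = s≤s z≤n
... | false | rem2 u       rewrite divMod3-triple u = s≤s z≤n

preimage-one : ∀ q → value q ≡ 1 → q ≡ 1
preimage-one q h with free q in e | mod3 q
... | true  | _            = contradiction h (double≢odd q 0)
... | false | rem0 u       rewrite divMod3-triple u = contradiction h (double≢odd u 0)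
... | false | rem1 zero    = refl
... | false | rem1 (suc u) = contradiction (trans (sym (free-3u+1 u)) e) λ ()
... | false | rem2 zero    = contradiction e λ ()
... | false | rem2 (suc u) rewrite divMod3-triple (suc u) = contradiction (suc-injective h) λ ()

assignedAfter : ℕ → State
assignedAfter m zero = nothing
assignedAfter m (suc q) with value (suc q) ≤? m
... | yes _ = just (value (suc q))
... | no  _ = nothing

assigned-yes : ∀ m q → 1 ≤ q → value q ≤ m → assignedAfter m q ≡ just (value q)
assigned-yes m (suc q) _ v≤m with value (suc q) ≤? m
... | yes _   = refl
... | no  v≰m = contradiction v≤m v≰m

assigned-no : ∀ m q → m < value q → assignedAfter m q ≡ nothing
assigned-no m zero    _   = refl
assigned-no m (suc q) m<v with value (suc q) ≤? m
... | yes v≤m = contradiction v≤m (<⇒≱ m<v)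
... | no  _   = refl

assigned-same : ∀ m q → value q ≢ suc m → assignedAfter (suc m) q ≡ assignedAfter m q
assigned-same m zero    _   = refl
assigned-same m (suc q) v≢m with value (suc q) ≤? suc m | value (suc q) ≤? m
... | yes _   | yes _   = refl
... | yes v≤1+m | no v≰m = contradiction (≤-antisym v≤1+m (≰⇒> v≰m)) v≢m
... | no v≰1+m | yes v≤m = contradiction (m≤n⇒m≤1+n v≤m) v≰1+m
... | no _    | no _    = refl

fill : ∀ {s m p} → (∀ q → s q ≡ assignedAfter m q) → value p ≡ suc m →
       (∀ q → value q ≡ suc m → q ≡ p) → ∀ q → update s p (suc m) q ≡ assignedAfter (suc m) q
fill {s} {m} {p} s≡ vp unique q with q ≟ p
... | yes refl = sym (trans (assigned-yes (suc m) q (positive q vp) (≤-reflexive vp)) (cong just vp))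
  where
  positive : ∀ q → value q ≡ suc m → 1 ≤ q
  positive (suc q) _ = s≤s z≤n
... | no q≢p = trans (s≡ q) (sym (assigned-same m q (λ v≡ → q≢p (unique q v≡))))

step-invariant : ∀ k → (∀ q → state (suc k) q ≡ assignedAfter (suc k) q) →
                 ∀ q → state (suc (suc k)) q ≡ assignedAfter (suc (suc k)) q
step-invariant k IH q
  with state (suc k) (left (suc (suc k))) | IH (left (suc (suc k)))
     | stepOutcome (suc (suc k)) (s≤s (s≤s z≤n))
... | nothing | _ | _ , fillsLeft vp unique      = fill IH vp unique q
... | nothing | e | 1≤p , fillsRight vp<m _ _   =
  contradiction (trans e (assigned-yes (suc k) (left (suc (suc k))) 1≤p (≤-pred vp<m))) λ ()
... | just _  | e | _ , fillsLeft vp _           =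
  contradiction (trans e (assigned-no (suc k) (left (suc (suc k))) (≤-reflexive (sym vp)))) λ ()
... | just _  | _ | _ , fillsRight _ vT unique  = fill IH vT unique q

state≡assignedAfter : ∀ m q → state m q ≡ assignedAfter m q
state≡assignedAfter zero          zero    = refl
state≡assignedAfter zero          (suc q) = sym (assigned-no 0 (suc q) (value-positive (suc q) (s≤s z≤n)))
state≡assignedAfter (suc zero)    q       = fill (state≡assignedAfter zero) refl preimage-one q
state≡assignedAfter (suc (suc k)) q       = step-invariant k (state≡assignedAfter (suc k)) q

Π42≡value : ∀ k → Π42 k ≡ value k
Π42≡value zero    = refl
Π42≡value (suc k) = cong (fromMaybe 0) (trans (state≡assignedAfter (2 * suc k) (suc k))
                      (assigned-yes (2 * suc k) (suc k) (s≤s z≤n) (≤-trans (value-≤ (suc k)) (≤-reflexive (twice (suc k))))))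

free⇒record : ∀ p → 1 ≤ p → free p ≡ true → IsRecordPos p
free⇒record p 1≤p e = 1≤p , λ m _ m<p → subst₂ _<_ (sym (Π42≡value m)) (sym (Π42≡value p))
  (subst (value m <_) (sym (value-free p e)) (≤-<-trans (value-≤ m) (+-mono-< m<p m<p)))

record-1 : IsRecordPos 1
record-1 = s≤s z≤n , λ m 1≤m m<1 → contradiction 1≤m (<⇒≱ m<1)

-- A taken position p ≥ 2 is beaten by an earlier free position (3u+4 for
-- p ∈ {3u+5, 3u+6}, and 2 for p = 3).
overtaken : ∀ p → 2 ≤ p → free p ≡ false → Σ ℕ λ m → 1 ≤ m × m < p × value p < value m
overtaken p 2≤p e with mod3 p
... | rem0 zero          = contradiction 2≤p λ ()
... | rem0 (suc zero)    = 2 , s≤s z≤n , ≤-refl , s≤s (s≤s (s≤s z≤n))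
... | rem0 (suc (suc w)) = suc (triple (suc w)) , s≤s z≤n , m<n⇒m<1+n (n<1+n _) ,
  subst₂ _<_ (sym (value-3u (suc w) (trans (sym (free-3u (suc w))) e))) (sym (value-3u+1 w))
    (+-mono-< below below)
  where
  below : suc (suc w) < suc (triple (suc w))
  below = s≤s (s≤s (s≤s (m≤n⇒m≤1+n (triple-≥ w))))
... | rem1 zero          = contradiction 2≤p λ { (s≤s ()) }
... | rem1 (suc w)       = contradiction (trans (sym (free-3u+1 w)) e) λ ()
... | rem2 zero          = contradiction e λ ()
... | rem2 (suc w)       = suc (triple (suc w)) , s≤s z≤n , ≤-refl ,
  subst₂ _<_ (sym (value-3u+2 w)) (sym (value-3u+1 w)) (odd<even (s≤s (s≤s (≤-trans (triple-≥ w) (m≤n+m _ 2)))))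

record⇒free : ∀ p → 2 ≤ p → IsRecordPos p → free p ≡ true
record⇒free p 2≤p (_ , beats) with free p in e
... | true  = refl
... | false with overtaken p 2≤p e
...   | m , 1≤m , m<p , vp<vm =
  contradiction (subst₂ _<_ (Π42≡value m) (Π42≡value p) (beats m 1≤m m<p)) (<⇒≯ vp<vm)

-- gap x is the distance from x to the next free position, read off from
-- whether x+1 and x+2 are free (no-three-taken rules out a longer gap).
gapBy : Bool → Bool → ℕ
gapBy true  _     = 1
gapBy false true  = 2
gapBy false false = 3

gap : ℕ → ℕ
gap x = gapBy (free (suc x)) (free (suc (suc x)))

next : ℕ → ℕ
next x = gap x + x

x<next : ∀ x → x < next x
x<next x with free (suc x) | free (suc (suc x))
... | true  | _     = ≤-refl
... | false | true  = n≤1+n _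
... | false | false = m≤n⇒m≤1+n (n≤1+n _)

next-free : ∀ x → 1 ≤ x → free (next x) ≡ true
next-free x 1≤x with free (suc x) in e₁ | free (suc (suc x)) in e₂
... | true  | _     = e₁
... | false | true  = e₂
... | false | false = no-three-taken x 1≤x e₁ e₂

next-record : ∀ x → 1 ≤ x → IsRecordPos (next x)
next-record x 1≤x = free⇒record (next x) (≤-trans 1≤x (<⇒≤ (x<next x))) (next-free x 1≤x)

taken≢free : ∀ {y z} → free y ≡ false → free z ≡ true → y ≢ z
taken≢free fy fz refl = contradiction (trans (sym fz) fy) λ ()

next-least : ∀ x z → x < z → free z ≡ true → next x ≤ z
next-least x z x<z fz with free (suc x) in e₁ | free (suc (suc x)) in e₂
... | true  | _     = x<z
... | false | true  = ≤∧≢⇒< x<z (taken≢free e₁ fz)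
... | false | false = ≤∧≢⇒< (≤∧≢⇒< x<z (taken≢free e₁ fz)) (taken≢free e₂ fz)

gap-3u+1 : ∀ u → free (suc (suc u)) ≡ true → gap (suc (triple (suc u))) ≡ 2
gap-3u+1 u h = cong₂ gapBy (free-3u+2 u) (trans (free-3u (suc u)) h)

gap-3u+1-taken : ∀ u → free (suc (suc u)) ≡ false → gap (suc (triple (suc u))) ≡ 3
gap-3u+1-taken u e = cong₂ gapBy (free-3u+2 u) (trans (free-3u (suc u)) e)

gap-3u : ∀ u → gap (triple (suc u)) ≡ 1
gap-3u u = cong (λ b → gapBy b (free (suc (suc (triple (suc u)))))) (free-3u+1 u)

gapWord : ℕ → ℕ → List ℕ
gapWord y zero    = []
gapWord y (suc k) = gap y ∷ gapWord (next y) k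

gapWord-++ : ∀ a b y → gapWord y (a + b) ≡ gapWord y a ++ gapWord (iterate next y a) b
gapWord-++ zero    b y = refl
gapWord-++ (suc a) b y = cong (gap y ∷_) (gapWord-++ a b (next y))

at-gapWord : ∀ k y i → i < k → at (gapWord y k) i ≡ gap (iterate next y i)
at-gapWord (suc k) y zero    _         = refl
at-gapWord (suc k) y (suc i) (s≤s i<k) = at-gapWord k (next y) i i<k

-- Self-similarity of the free positions: y ↦ 3y - 2 sends free positions y ≥ 2
-- to free positions, and the gaps from image y up to image (next y) spell
-- τ(gap y).
image : ℕ → ℕ
image y = suc (triple (y ∸ 1))

τ-block : ∀ y → 2 ≤ y → free y ≡ true →
          Σ ℕ λ c → 1 ≤ c × τ (gap y) ≡ gapWord (image y) c × iterate next (image y) c ≡ image (next y)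
τ-block (suc (suc v)) _ h with free (suc (suc (suc v))) in e₁ | free (suc (suc (suc (suc v)))) in e₂
... | true  | _     = 2 , s≤s z≤n , word , end
  where
  word : 2 ∷ 1 ∷ [] ≡ gapWord (image (suc (suc v))) 2
  word rewrite gap-3u+1 v h | gap-3u (suc v) = refl
  end : iterate next (image (suc (suc v))) 2 ≡ image (suc (suc (suc v)))
  end rewrite gap-3u+1 v h | gap-3u (suc v) = refl
... | false | true  = 3 , s≤s z≤n , word , end
  where
  word : 2 ∷ 1 ∷ 3 ∷ [] ≡ gapWord (image (suc (suc v))) 3
  word rewrite gap-3u+1 v h | gap-3u (suc v) | gap-3u+1-taken (suc v) e₁ = refl
  end : iterate next (image (suc (suc v))) 3 ≡ image (suc (suc (suc (suc v))))
  end rewrite gap-3u+1 v h | gap-3u (suc v) | gap-3u+1-taken (suc v) e₁ = refl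
... | false | false = 4 , s≤s z≤n , word , end
  where
  word : 2 ∷ 1 ∷ 3 ∷ 3 ∷ [] ≡ gapWord (image (suc (suc v))) 4
  word rewrite gap-3u+1 v h | gap-3u (suc v) | gap-3u+1-taken (suc v) e₁
             | gap-3u+1-taken (suc (suc v)) e₂ = refl
  end : iterate next (image (suc (suc v))) 4 ≡ image (suc (suc (suc (suc (suc v)))))
  end rewrite gap-3u+1 v h | gap-3u (suc v) | gap-3u+1-taken (suc v) e₁
            | gap-3u+1-taken (suc (suc v)) e₂ = refl

τ-gapWord : ∀ k y → 2 ≤ y → free y ≡ true →
            Σ ℕ λ k′ → τ* (gapWord y k) ≡ gapWord (image y) k′ × k ≤ k′
τ-gapWord zero    y 2≤y h = 0 , refl , z≤n
τ-gapWord (suc k) y 2≤y h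
  with τ-block y 2≤y h
     | τ-gapWord k (next y) (≤-trans 2≤y (<⇒≤ (x<next y))) (next-free y (≤-trans (s≤s z≤n) 2≤y))
... | c , 1≤c , word , end | k′ , rest , k≤k′ = c + k′ , blocks , +-mono-≤ 1≤c k≤k′
  where
  open ≡-Reasoning
  blocks : τ (gap y) ++ τ* (gapWord (next y) k) ≡ gapWord (image y) (c + k′)
  blocks = begin
    τ (gap y) ++ τ* (gapWord (next y) k)                     ≡⟨ cong₂ _++_ word rest ⟩
    gapWord (image y) c ++ gapWord (image (next y)) k′        ≡⟨ cong (λ z → gapWord (image y) c ++ gapWord z k′) (sym end) ⟩
    gapWord (image y) c ++ gapWord (iterate next (image y) c) k′ ≡⟨ sym (gapWord-++ c k′ (image y)) ⟩
    gapWord (image y) (c + k′)                                ∎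

τ-power : ∀ k → Σ ℕ λ k′ → τ^ k ≡ 4 ∷ gapWord 4 k′ × k ≤ k′
τ-power zero = 0 , refl , z≤n
τ-power (suc k) with τ-power k
... | k′ , eq , k≤k′ with τ-gapWord k′ 4 (s≤s (s≤s z≤n)) refl
...   | k″ , eq′ , k′≤k″ =
  3 + k″ , trans (cong τ* eq) (cong (λ w → 4 ∷ 2 ∷ 1 ∷ 3 ∷ w) eq′) ,
  s≤s (≤-trans (≤-trans k≤k′ k′≤k″) (m≤n+m k″ 2))

t-gap : ∀ i → t (2 + i) ≡ gap (fold 4 next i)
t-gap i with τ-power (2 + i)
... | k , eq , 2+i≤k = begin
  at (τ^ (2 + i)) (suc i)    ≡⟨ cong (λ w → at w (suc i)) eq ⟩
  at (gapWord 4 k) i          ≡⟨ at-gapWord k 4 i (≤-trans (n≤1+n _) 2+i≤k) ⟩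
  gap (iterate next 4 i)      ≡⟨ cong gap (sym (iterate-is-fold 4 next i)) ⟩
  gap (fold 4 next i)         ∎
  where open ≡-Reasoning

module _ {f : ℕ → ℕ} (increasing : ∀ k → 1 ≤ k → f k < f (suc k)) where

  increasing-< : ∀ i j → 1 ≤ i → i < j → f i < f j
  increasing-< i (suc j) 1≤i (s≤s i≤j) with m≤n⇒m<n∨m≡n i≤j
  ... | inj₁ i<j  = <-trans (increasing-< i j 1≤i i<j) (increasing j (≤-trans 1≤i (<⇒≤ i<j)))
  ... | inj₂ refl = increasing i 1≤i

  increasing-≤ : ∀ i j → 1 ≤ i → i ≤ j → f i ≤ f j
  increasing-≤ i j 1≤i i≤j with m≤n⇒m<n∨m≡n i≤j
  ... | inj₁ i<j  = <⇒≤ (increasing-< i j 1≤i i<j)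
  ... | inj₂ refl = ≤-refl

  increasing-reflects : ∀ i j → 1 ≤ j → f i < f j → i < j
  increasing-reflects i j 1≤j fi<fj with <-cmp i j
  ... | tri< i<j _ _   = i<j
  ... | tri≈ _ refl _ = contradiction fi<fj (<-irrefl refl)
  ... | tri> _ _ j<i   = contradiction fi<fj (<-asym (increasing-< j i 1≤j j<i))

module RecordEnumeration (f : ℕ → ℕ) (isEnum : IsRecordEnumeration f) where

  increasing : ∀ k → 1 ≤ k → f k < f (suc k)
  increasing = proj₁ isEnum

  records : ∀ k → 1 ≤ k → IsRecordPos (f k)
  records = proj₁ (proj₂ isEnum)

  complete : ∀ p → IsRecordPos p → Σ ℕ λ k → 1 ≤ k × f k ≡ p
  complete = proj₂ (proj₂ isEnum)

  positive : ∀ k → 1 ≤ k → 1 ≤ f k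
  positive k 1≤k = proj₁ (records k 1≤k)

  -- Terms from the second on are records beyond 1, hence free.
  free-at : ∀ k → 2 ≤ k → free (f k) ≡ true
  free-at (suc k) (s≤s 1≤k) =
    record⇒free (f (suc k)) (≤-trans (s≤s (positive k 1≤k)) (increasing k 1≤k)) (records (suc k) (s≤s z≤n))

  -- 1 is a record, and no term lies below f 1.
  first : f 1 ≡ 1
  first with complete 1 record-1
  ... | k , 1≤k , fk≡1 with m≤n⇒m<n∨m≡n 1≤k
  ...   | inj₂ refl = fk≡1
  ...   | inj₁ 1<k  =
    contradiction (positive 1 ≤-refl) (<⇒≱ (subst (f 1 <_) fk≡1 (increasing-< increasing 1 k ≤-refl 1<k)))

  -- next (f k) is a record, so some later term equals it; no term lies strictly
  -- between f k and next (f k), since there is no free position there.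
  successor : ∀ k → 1 ≤ k → f (suc k) ≡ next (f k)
  successor k 1≤k with complete (next (f k)) (next-record (f k) (positive k 1≤k))
  ... | j , 1≤j , fj≡y = ≤-antisym at-most at-least
    where
    k<j : k < j
    k<j = increasing-reflects increasing k j 1≤j (subst (f k <_) (sym fj≡y) (x<next (f k)))
    at-most : f (suc k) ≤ next (f k)
    at-most = subst (f (suc k) ≤_) fj≡y (increasing-≤ increasing (suc k) j (s≤s z≤n) k<j)
    at-least : next (f k) ≤ f (suc k)
    at-least = next-least (f k) (f (suc k)) (increasing k 1≤k) (free-at (suc k) (s≤s 1≤k))

  from-third : ∀ i → f (3 + i) ≡ fold 4 next i
  from-third zero    = trans (successor 2 (s≤s z≤n)) (cong next (trans (successor 1 ≤-refl) (cong next first)))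
  from-third (suc i) = trans (successor (3 + i) (s≤s z≤n)) (cong next (from-third i))

  Π42-at : ∀ k → 2 ≤ k → Π42 (f k) ≡ f k + f k
  Π42-at k 2≤k = trans (Π42≡value (f k)) (value-free (f k) (free-at k 2≤k))

proposition5 : (Rpos : ℕ → ℕ) → IsRecordEnumeration Rpos →
    ∀ n → 2 ≤ n →
      (Rpos (n + 2) ≡ Rpos (n + 1) + t n) ×
      (Π42 (Rpos (n + 2)) ≡ Π42 (Rpos (n + 1)) + 2 * t n)
proposition5 Rpos isEnum n@(suc (suc i)) 2≤n@(s≤s (s≤s _)) = positions , values
  where
  open RecordEnumeration Rpos isEnum
  open ≡-Reasoning

  X : ℕ
  X = Rpos (n + 1)

  t≡gap : t n ≡ gap X
  t≡gap = trans (t-gap i) (cong gap (sym (trans (cong Rpos (+-comm n 1)) (from-third i))))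

  positions : Rpos (n + 2) ≡ X + t n
  positions = begin
    Rpos (n + 2)       ≡⟨ cong Rpos (+-suc n 1) ⟩
    Rpos (suc (n + 1)) ≡⟨ successor (n + 1) (m≤n+m 1 n) ⟩
    gap X + X          ≡⟨ +-comm (gap X) X ⟩
    X + gap X          ≡⟨ cong (X +_) (sym t≡gap) ⟩
    X + t n            ∎

  values : Π42 (Rpos (n + 2)) ≡ Π42 X + 2 * t n
  values = begin
    Π42 (Rpos (n + 2))          ≡⟨ Π42-at (n + 2) (m≤n+m 2 n) ⟩
    Rpos (n + 2) + Rpos (n + 2) ≡⟨ cong (λ y → y + y) positions ⟩
    (X + t n) + (X + t n)       ≡⟨ regroup X (t n) ⟩
    (X + X) + 2 * t n           ≡⟨ cong (_+ 2 * t n) (sym (Π42-at (n + 1) (≤-trans 2≤n (m≤m+n n 1)))) ⟩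
    Π42 X + 2 * t n             ∎
    where
    regroup : ∀ a b → (a + b) + (a + b) ≡ (a + a) + 2 * b
    regroup = solve-∀
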